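{- Let $n\ge 1$, $1\le m<2^{n/2}$ and $a\ge 0$ be integers. Let $R=\mathcal{X}\times\mathcal{Y}$ with $\mathcal{X},\mathcal{Y}\subseteq\{0,1\}^{nm+a}$ be a rectangle with $|R|\ge 2^{2nm+2a-m+2}$. Write each element of $R$ as $(X\circ t_x,\,Y\circ t_y)$, where $X,Y\in\{0,1\}^{nm}$ are lists of $m$ strings from $\{0,1\}^n$ and $t_x,t_y\in\{0,1\}^a$. Let $s\in\{0,1\}^n$. Then there is a subrectangle $R'\subseteq R$ with $|R'|\ge 2^{ -2n-2}|R|$ such that, for every $(X\circ t_x,Y\circ t_y)\in R'$, $s$ is not a solution to $\textsc{XOR-Missing-String}$ on $(X,Y)$.
   Context: For $X=(x_1,\dots,x_m)$ and $Y=(y_1,\dots,y_m)$ with all strings in $\{0,1\}^n$, a string $s\in\{0,1\}^n$ is a solution to $\textsc{XOR-Missing-String}$ on $(X,Y)$ if $s\ne x_i\oplus y_j$ for all $i,j\in[m]$. A subrectangle of $\mathcal{X}\times\mathcal{Y}$ is a set $\mathcal{X}'\times\mathcal{Y}'$ with $\mathcal{X}'\subseteq\mathcal{X}$ and $\mathcal{Y}'\subseteq\mathcal{Y}$. -}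

module Defs where

open import Data.Bool using (Bool; _xor_)
open import Data.Nat using (ℕ; _*_; _+_)
open import Data.Vec using (Vec; zipWith; take; group; lookup)
open import Data.Fin using (Fin)
open import Data.Product using (proj₁)
open import Relation.Binary.PropositionalEquality using (_≢_)

BitStr : ℕ → Set
BitStr k = Vec Bool k

_⊕_ : ∀ {k} → BitStr k → BitStr k → BitStr k
_⊕_ = zipWith _xor_

Lists : ℕ → ℕ → Set
Lists m n = Vec (BitStr n) m

IsXMSSolution : ∀ {m n} → Lists m n → Lists m n → BitStr n → Set
IsXMSSolution {m} X Y s = ∀ (i j : Fin m) → s ≢ (lookup X i ⊕ lookup Y j)

-- Decomposition of z = X ∘ t ∈ {0,1}^{nm+a}: the first nm bits, split into m blocks of n bits
listPart : ∀ m n a → BitStr (m * n + a) → Lists m n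
listPart m n a z = proj₁ (group m n (take (m * n) z))

-- Call a key u ∈ {0,1}ⁿ heavy for 𝒳 if at least a 1/(2·2ⁿ) fraction of 𝒳 has a block equal to u,
-- and heavy for 𝒴 if at least that fraction of 𝒴 has a block b with b ⊕ s = u. A key heavy for both
-- gives the subrectangle of those x and y, on each pair of which s = xᵢ ⊕ yⱼ. Otherwise let p and q
-- count the 𝒳-heavy and 𝒳-light keys, so p + q = 2ⁿ. A union bound over the at most 2ⁿ light keys
-- shows that at least half of 𝒳 has only 𝒳-heavy blocks, and at least half of 𝒴 only blocks b with
-- b ⊕ s 𝒴-heavy, hence 𝒳-light. Counting such strings, |𝒳||𝒴| ≤ 4 (p^m 2^a)(q^m 2^a), and by AM-GM
-- pq ≤ 2^{2n}/4, which puts |𝒳||𝒴| below the assumed 2^{2nm+2a-m+2}.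
module Submission where

open import Defs
open import Data.Bool using (true; false; _xor_)
open import Data.Bool.Properties using (xor-assoc; xor-comm; xor-same; xor-identityʳ)
import Data.Bool.Properties as Bool
open import Data.Empty using (⊥-elim)
open import Data.Fin using (Fin; zero; suc)
open import Data.Fin.Properties using (any?; all?; ¬∀⟶∃¬)
open import Data.List using (List; []; _∷_; length; filter; map; cartesianProductWith)
open import Data.List.Properties using (length-++; length-map; length-filter; filter-none; filter-notAll)
open import Data.List.Membership.Propositional using (_∈_; lose)
open import Data.List.Membership.Propositional.Properties
  using (∈-filter⁺; ∈-filter⁻; ∈-map⁺; ∈-cartesianProductWith⁺)
open import Data.List.Relation.Unary.All as All using ()
open import Data.List.Relation.Unary.AllPairs using (_∷_)
open import Data.List.Relation.Unary.Any as Any using (Any; here; there)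
open import Data.List.Relation.Unary.Any.Properties using (¬Any[])
open import Data.List.Relation.Unary.Unique.Propositional using (Unique)
open import Data.List.Relation.Unary.Unique.Propositional.Properties using (filter⁺)
open import Data.Nat using (ℕ; zero; suc; _*_; _+_; _∸_; _^_; _≤_; _<_; z≤n; s≤s; NonZero; >-nonZero)
open import Data.Nat.Properties
open import Data.Nat.Tactic.RingSolver using (solve-∀)
open import Data.Vec using (Vec; []; _∷_; _++_; lookup; take; drop; concat; group)
open import Data.Vec.Properties using (≡-dec; zipWith-comm; take++drop≡id)
open import Data.Product using (Σ; ∃; _×_; _,_; proj₁; proj₂)
open import Data.Sum using (_⊎_; [_,_]; [_,_]′)
open import Function using (_∘_; id)
open import Relation.Binary.Definitions using (DecidableEquality)
open import Relation.Binary.PropositionalEquality hiding ([_])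
open import Relation.Nullary using (¬_; yes; no; does; ¬?; _×-dec_)
open import Level using (Level; 0ℓ)
open import Relation.Unary using (Pred; Decidable)
open import Relation.Unary.Properties using (∁?)

module _ {A : Set} {ℓ : Level} where

  count : {P : Pred A ℓ} → Decidable P → List A → ℕ
  count P? xs = length (filter P? xs)

  count+count∁≡length : {P : Pred A ℓ} (P? : Decidable P) (xs : List A) →
                        count P? xs + count (∁? P?) xs ≡ length xs
  count+count∁≡length P? [] = refl
  count+count∁≡length P? (x ∷ xs) with does (P? x)
  ... | true  = cong suc (count+count∁≡length P? xs)
  ... | false = trans (+-suc _ _) (cong suc (count+count∁≡length P? xs))

  count-⊎ : {P Q R : Pred A ℓ} (P? : Decidable P) (Q? : Decidable Q) (R? : Decidable R) →
            (∀ {x} → P x → Q x ⊎ R x) → ∀ xs → count P? xs ≤ count Q? xs + count R? xs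
  count-⊎ P? Q? R? cover [] = z≤n
  count-⊎ P? Q? R? cover (x ∷ xs) with ih ← count-⊎ P? Q? R? cover xs | P? x | Q? x | R? x
  ... | yes _ | yes _ | yes _ = s≤s (≤-trans ih (+-monoʳ-≤ (count Q? xs) (n≤1+n _)))
  ... | yes _ | yes _ | no  _ = s≤s ih
  ... | yes _ | no  _ | yes _ = ≤-trans (s≤s ih) (≤-reflexive (sym (+-suc (count Q? xs) (count R? xs))))
  ... | yes p | no ¬q | no ¬r = ⊥-elim ([ ¬q , ¬r ] (cover p))
  ... | no  _ | yes _ | yes _ = ≤-trans ih (+-mono-≤ (n≤1+n _) (n≤1+n _))
  ... | no  _ | yes _ | no  _ = ≤-trans ih (+-monoˡ-≤ (count R? xs) (n≤1+n _))
  ... | no  _ | no  _ | yes _ = ≤-trans ih (+-monoʳ-≤ (count Q? xs) (n≤1+n _))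
  ... | no  _ | no  _ | no  _ = ih

module _ {A K : Set} {ℓ : Level} {P : K → Pred A ℓ} (P? : ∀ u → Decidable (P u)) (xs : List A) where

  union-bound : ∀ {c L} (us : List K) → (∀ {u} → u ∈ us → c * count (P? u) xs ≤ L) →
                {Q : Pred A ℓ} (Q? : Decidable Q) → (∀ {x} → Q x → Any (λ u → P u x) us) →
                c * count Q? xs ≤ length us * L
  union-bound {c} [] _ Q? cover = ≤-reflexive (begin
    c * count Q? xs ≡⟨ cong (λ ys → c * length ys) (filter-none Q? {xs} (All.tabulate λ _ q → ¬Any[] (cover q))) ⟩
    c * 0           ≡⟨ *-zeroʳ c ⟩
    0               ∎)
    where open ≡-Reasoning
  union-bound {c} {L} (u ∷ us) light Q? cover = begin
    c * count Q? xs                            ≤⟨ *-monoʳ-≤ c (count-⊎ Q? (P? u) rest? (Any.toSum ∘ cover) xs) ⟩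
    c * (count (P? u) xs + count rest? xs)     ≡⟨ *-distribˡ-+ c _ _ ⟩
    c * count (P? u) xs + c * count rest? xs   ≤⟨ +-mono-≤ (light (here refl))
                                                     (union-bound {c} us (light ∘ there) rest? id) ⟩
    L + length us * L                          ∎
    where
      open ≤-Reasoning
      rest? : Decidable (λ x → Any (λ v → P v x) us)
      rest? x = Any.any? (λ v → P? v x) us

  at-least-half : (N : ℕ) .{{_ : NonZero N}} (us : List K) → length us ≤ N →
                  (∀ {u} → u ∈ us → 2 * N * count (P? u) xs ≤ length xs) →
                  {G : Pred A ℓ} (G? : Decidable G) → (∀ {x} → ¬ G x → Any (λ u → P u x) us) →
                  length xs ≤ 2 * count G? xs
  at-least-half N us us≤N light G? cover = begin
    length xs   ≡⟨ count+count∁≡length G? xs ⟨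
    good + bad  ≤⟨ +-monoʳ-≤ good bad≤good ⟩
    good + good ≡⟨ cong (good +_) (+-identityʳ good) ⟨
    2 * good    ∎
    where
      open ≤-Reasoning
      good bad : ℕ
      good = count G? xs
      bad  = count (∁? G?) xs
      N*2bad≤N*length : N * (2 * bad) ≤ N * length xs
      N*2bad≤N*length = begin
        N * (2 * bad)         ≡⟨ trans (sym (*-assoc N 2 bad)) (cong (_* bad) (*-comm N 2)) ⟩
        2 * N * bad           ≤⟨ union-bound {2 * N} us light (∁? G?) cover ⟩
        length us * length xs ≤⟨ *-monoˡ-≤ (length xs) us≤N ⟩
        N * length xs         ∎
      bad≤good : bad ≤ good
      bad≤good = +-cancelʳ-≤ bad bad good (begin
        bad + bad  ≡⟨ cong (bad +_) (+-identityʳ bad) ⟨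
        2 * bad    ≤⟨ *-cancelˡ-≤ N N*2bad≤N*length ⟩
        length xs  ≡⟨ count+count∁≡length G? xs ⟨
        good + bad ∎)

⊆-Unique⇒length≤ : {A : Set} → DecidableEquality A → {xs ys : List A} →
                    Unique xs → (∀ {x} → x ∈ xs → x ∈ ys) → length xs ≤ length ys
⊆-Unique⇒length≤ _≟_ {[]} _ _ = z≤n
⊆-Unique⇒length≤ _≟_ {x ∷ xs} {ys} (x∉xs ∷ uxs) xs⊆ys = begin-strict
  length xs              ≤⟨ ⊆-Unique⇒length≤ _≟_ uxs xs⊆ys-x ⟩
  length (filter ≢x? ys) <⟨ filter-notAll ≢x? ys (Any.map (λ x≡y y≢x → y≢x (sym x≡y)) (xs⊆ys (here refl))) ⟩
  length ys              ∎
  where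
    open ≤-Reasoning
    ≢x? : Decidable (_≢ x)
    ≢x? y = ¬? (y ≟ x)
    xs⊆ys-x : ∀ {y} → y ∈ xs → y ∈ filter ≢x? ys
    xs⊆ys-x y∈xs = ∈-filter⁺ ≢x? (xs⊆ys (there y∈xs)) (λ y≡x → All.lookup x∉xs y∈xs (sym y≡x))

length-cartesianProductWith : {A B C : Set} (f : A → B → C) (xs : List A) (ys : List B) →
                              length (cartesianProductWith f xs ys) ≡ length xs * length ys
length-cartesianProductWith f [] ys = refl
length-cartesianProductWith f (x ∷ xs) ys = begin
  length (cartesianProductWith f (x ∷ xs) ys)                   ≡⟨ length-++ (map (f x) ys) ⟩
  length (map (f x) ys) + length (cartesianProductWith f xs ys) ≡⟨ cong₂ _+_ (length-map (f x) ys)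
                                                                    (length-cartesianProductWith f xs ys) ⟩
  length ys + length xs * length ys                             ∎
  where open ≡-Reasoning

module _ {A : Set} where

  vecsOver : List A → (k : ℕ) → List (Vec A k)
  vecsOver S zero    = [] ∷ []
  vecsOver S (suc k) = cartesianProductWith _∷_ S (vecsOver S k)

  length-vecsOver : ∀ S k → length (vecsOver S k) ≡ length S ^ k
  length-vecsOver S zero    = refl
  length-vecsOver S (suc k) = trans (length-cartesianProductWith _∷_ S (vecsOver S k))
                                    (cong (length S *_) (length-vecsOver S k))

  ∈-vecsOver⁺ : ∀ {S k} {v : Vec A k} → (∀ i → lookup v i ∈ S) → v ∈ vecsOver S k
  ∈-vecsOver⁺ {v = []}    _   = here refl
  ∈-vecsOver⁺ {v = x ∷ v} v∈S = ∈-cartesianProductWith⁺ _∷_ (v∈S zero) (∈-vecsOver⁺ (v∈S ∘ suc))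

bitStrings : (k : ℕ) → List (BitStr k)
bitStrings = vecsOver (true ∷ false ∷ [])

length-bitStrings : ∀ k → length (bitStrings k) ≡ 2 ^ k
length-bitStrings = length-vecsOver (true ∷ false ∷ [])

∈-bitStrings : ∀ {k} (v : BitStr k) → v ∈ bitStrings k
∈-bitStrings v = ∈-vecsOver⁺ (λ i → bit∈ (lookup v i))
  where
    bit∈ : ∀ b → b ∈ true ∷ false ∷ []
    bit∈ true  = here refl
    bit∈ false = there (here refl)

_≟ᵇˢ_ : ∀ {k} → DecidableEquality (BitStr k)
_≟ᵇˢ_ = ≡-dec Bool._≟_

⊕-comm : ∀ {k} (b c : BitStr k) → b ⊕ c ≡ c ⊕ b
⊕-comm = zipWith-comm xor-comm

⊕-cancelʳ : ∀ {k} (b c : BitStr k) → (b ⊕ c) ⊕ c ≡ b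
⊕-cancelʳ []      []      = refl
⊕-cancelʳ (x ∷ b) (y ∷ c) = cong₂ _∷_ xor-cancel (⊕-cancelʳ b c)
  where
    xor-cancel : (x xor y) xor y ≡ x
    xor-cancel = trans (xor-assoc x y y) (trans (cong (x xor_) (xor-same y)) (xor-identityʳ x))

module _ (m n a : ℕ) where

  concat-listPart-++-drop : (z : BitStr (m * n + a)) → concat (listPart m n a z) ++ drop (m * n) z ≡ z
  concat-listPart-++-drop z = begin
    concat (listPart m n a z) ++ drop (m * n) z ≡⟨ cong (_++ drop (m * n) z) concat-listPart≡take ⟨
    take (m * n) z ++ drop (m * n) z            ≡⟨ take++drop≡id (m * n) z ⟩
    z                                           ∎
    where
      open ≡-Reasoning
      concat-listPart≡take : take (m * n) z ≡ concat (listPart m n a z)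
      concat-listPart≡take = proj₂ (group m n (take (m * n) z))

  blocksIn⇒length≤ : (S : List (BitStr n)) {zs : List (BitStr (m * n + a))} → Unique zs →
                     (∀ {z} → z ∈ zs → ∀ i → lookup (listPart m n a z) i ∈ S) →
                     length zs ≤ length S ^ m * 2 ^ a
  blocksIn⇒length≤ S {zs} unique blocks∈S = begin
    length zs                                     ≤⟨ ⊆-Unique⇒length≤ _≟ᵇˢ_ unique zs⊆withBlocksInS ⟩
    length withBlocksInS                          ≡⟨ length-cartesianProductWith join (vecsOver S m) (bitStrings a) ⟩
    length (vecsOver S m) * length (bitStrings a) ≡⟨ cong₂ _*_ (length-vecsOver S m) (length-bitStrings a) ⟩
    length S ^ m * 2 ^ a                          ∎
    where
      open ≤-Reasoning
      join : Vec (BitStr n) m → BitStr a → BitStr (m * n + a)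
      join bs t = concat bs ++ t
      withBlocksInS : List (BitStr (m * n + a))
      withBlocksInS = cartesianProductWith join (vecsOver S m) (bitStrings a)
      zs⊆withBlocksInS : ∀ {z} → z ∈ zs → z ∈ withBlocksInS
      zs⊆withBlocksInS {z} z∈zs = subst (_∈ withBlocksInS) (concat-listPart-++-drop z)
        (∈-cartesianProductWith⁺ join (∈-vecsOver⁺ {v = listPart m n a z} (blocks∈S z∈zs))
                                      (∈-bitStrings (drop (m * n) z)))

^-distribʳ-* : ∀ x y k → (x * y) ^ k ≡ x ^ k * y ^ k
^-distribʳ-* x y zero    = refl
^-distribʳ-* x y (suc k) = trans (cong (x * y *_) (^-distribʳ-* x y k)) (interchange x y (x ^ k) (y ^ k))
  where
    interchange : ∀ x y u v → x * y * (u * v) ≡ x * u * (y * v)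
    interchange = solve-∀

4*[m*n]≤[m+n]*[m+n] : ∀ m n → 4 * (m * n) ≤ (m + n) * (m + n)
4*[m*n]≤[m+n]*[m+n] m n = [ ordered , flipped ]′ (≤-total m n)
  where
    -- with n = m + d the two sides differ by exactly d * d
    ordered : ∀ {m n} → m ≤ n → 4 * (m * n) ≤ (m + n) * (m + n)
    ordered {m} {n} m≤n rewrite sym (m+[n∸m]≡n m≤n) =
      subst (4 * (m * (m + (n ∸ m))) ≤_) (sym (expansion m (n ∸ m))) (m≤m+n _ _)
      where
        expansion : ∀ m d → (m + (m + d)) * (m + (m + d)) ≡ 4 * (m * (m + d)) + d * d
        expansion = solve-∀
    flipped : n ≤ m → 4 * (m * n) ≤ (m + n) * (m + n)
    flipped n≤m = subst₂ (λ u v → 4 * u ≤ v * v) (*-comm n m) (+-comm n m) (ordered n≤m)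

4^k*[p^k*q^k]≤2^[2nk] : ∀ {p q} n k → p + q ≡ 2 ^ n → 4 ^ k * (p ^ k * q ^ k) ≤ 2 ^ ((n + n) * k)
4^k*[p^k*q^k]≤2^[2nk] {p} {q} n k p+q≡2^n = begin
  4 ^ k * (p ^ k * q ^ k)       ≡⟨ cong (4 ^ k *_) (^-distribʳ-* p q k) ⟨
  4 ^ k * (p * q) ^ k           ≡⟨ ^-distribʳ-* 4 (p * q) k ⟨
  (4 * (p * q)) ^ k             ≤⟨ ^-monoˡ-≤ k (4*[m*n]≤[m+n]*[m+n] p q) ⟩
  ((p + q) * (p + q)) ^ k       ≡⟨ cong (λ N → (N * N) ^ k) p+q≡2^n ⟩
  (2 ^ n * 2 ^ n) ^ k           ≡⟨ cong (_^ k) (^-distribˡ-+-* 2 n n) ⟨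
  (2 ^ (n + n)) ^ k             ≡⟨ ^-*-assoc 2 (n + n) k ⟩
  2 ^ ((n + n) * k)             ∎
  where open ≤-Reasoning

product<2^[2nm+2a∸m+2] : ∀ n m a {p q X Y} → 1 ≤ n → 1 ≤ m → p + q ≡ 2 ^ n →
                         X ≤ 2 * (p ^ m * 2 ^ a) → Y ≤ 2 * (q ^ m * 2 ^ a) →
                         X * Y < 2 ^ (2 * n * m + 2 * a ∸ m + 2)
product<2^[2nm+2a∸m+2] n m a {p} {q} {X} {Y} 1≤n 1≤m p+q≡2^n X≤ Y≤ =
  *-cancelˡ-< (4 ^ m) (X * Y) _ (begin-strict
    4 ^ m * (X * Y)                             ≤⟨ *-monoʳ-≤ (4 ^ m) (*-mono-≤ X≤ Y≤) ⟩
    4 ^ m * (2 * (p ^ m * A) * (2 * (q ^ m * A))) ≡⟨ regroup (4 ^ m) (p ^ m) (q ^ m) A ⟩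
    4 * (4 ^ m * (p ^ m * q ^ m)) * (A * A)     ≤⟨ *-monoˡ-≤ (A * A) (*-monoʳ-≤ 4 powers≤) ⟩
    4 * 2 ^ ((n + n) * m) * (A * A)             ≡⟨ 2-powers ⟩
    2 ^ (E + 2)                                 <⟨ ^-monoʳ-< 2 (s≤s (s≤s z≤n)) (m<m+n (E + 2) 1≤m) ⟩
    2 ^ (E + 2 + m)                             ≡⟨ cong (2 ^_) lower-exponent ⟩
    2 ^ (2 * m + (E ∸ m + 2))                   ≡⟨ ^-distribˡ-+-* 2 (2 * m) (E ∸ m + 2) ⟩
    2 ^ (2 * m) * 2 ^ (E ∸ m + 2)               ≡⟨ cong (_* 2 ^ (E ∸ m + 2)) (^-*-assoc 2 2 m) ⟨
    4 ^ m * 2 ^ (E ∸ m + 2)                     ∎)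
  where
    open ≤-Reasoning
    A E : ℕ
    A = 2 ^ a
    E = 2 * n * m + 2 * a
    regroup : ∀ f u v w → f * (2 * (u * w) * (2 * (v * w))) ≡ 4 * (f * (u * v)) * (w * w)
    regroup = solve-∀
    powers≤ : 4 ^ m * (p ^ m * q ^ m) ≤ 2 ^ ((n + n) * m)
    powers≤ = 4^k*[p^k*q^k]≤2^[2nk] n m p+q≡2^n
    2-powers : 4 * 2 ^ ((n + n) * m) * (A * A) ≡ 2 ^ (E + 2)
    2-powers = begin-equality
      4 * 2 ^ ((n + n) * m) * (A * A)     ≡⟨ cong (4 * 2 ^ ((n + n) * m) *_) (^-distribˡ-+-* 2 a a) ⟨
      4 * 2 ^ ((n + n) * m) * 2 ^ (a + a) ≡⟨ cong (_* 2 ^ (a + a)) (^-distribˡ-+-* 2 2 ((n + n) * m)) ⟨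
      2 ^ (2 + (n + n) * m) * 2 ^ (a + a) ≡⟨ ^-distribˡ-+-* 2 (2 + (n + n) * m) (a + a) ⟨
      2 ^ (2 + (n + n) * m + (a + a))     ≡⟨ cong (2 ^_) (exponent n m a) ⟩
      2 ^ (E + 2)                         ∎
      where
        exponent : ∀ n m a → 2 + (n + n) * m + (a + a) ≡ 2 * n * m + 2 * a + 2
        exponent = solve-∀
    m≤E : m ≤ E
    m≤E = ≤-trans (m≤n*m m (2 * n) {{>-nonZero (≤-trans 1≤n (m≤m+n n (n + 0)))}}) (m≤m+n _ _)
    lower-exponent : E + 2 + m ≡ 2 * m + (E ∸ m + 2)
    lower-exponent = trans (cong (λ e → e + 2 + m) (sym (m∸n+n≡m m≤E))) (exponent (E ∸ m) m)
      where
        exponent : ∀ d m → d + m + 2 + m ≡ 2 * m + (d + 2)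
        exponent = solve-∀

product≤2^[2n+2]*product : ∀ n {X Y x y} → X ≤ 2 * 2 ^ n * x → Y ≤ 2 * 2 ^ n * y →
                           X * Y ≤ 2 ^ (2 * n + 2) * (x * y)
product≤2^[2n+2]*product n {X} {Y} {x} {y} X≤ Y≤ = begin
  X * Y                               ≤⟨ *-mono-≤ X≤ Y≤ ⟩
  2 * 2 ^ n * x * (2 * 2 ^ n * y)     ≡⟨ regroup (2 ^ n) x y ⟩
  2 ^ 2 * (2 ^ n * 2 ^ n) * (x * y)   ≡⟨ cong (λ e → 2 ^ 2 * e * (x * y)) (^-distribˡ-+-* 2 n n) ⟨
  2 ^ 2 * 2 ^ (n + n) * (x * y)       ≡⟨ cong (_* (x * y)) (^-distribˡ-+-* 2 2 (n + n)) ⟨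
  2 ^ (2 + (n + n)) * (x * y)         ≡⟨ cong (λ e → 2 ^ e * (x * y)) (exponent n) ⟩
  2 ^ (2 * n + 2) * (x * y)           ∎
  where
    open ≤-Reasoning
    regroup : ∀ N x y → 2 * N * x * (2 * N * y) ≡ 4 * (N * N) * (x * y)
    regroup = solve-∀
    exponent : ∀ n → 2 + (n + n) ≡ 2 * n + 2
    exponent = solve-∀

module HeavyKeys (n m a : ℕ) where

  -- The keys of z are its blocks relabelled by g; we use g = id on 𝒳 and g = _⊕ s on 𝒴,
  -- so that a key shared by x and y is a pair of blocks with xᵢ ⊕ yⱼ = s.
  key : (BitStr n → BitStr n) → BitStr (m * n + a) → Fin m → BitStr n
  key g z i = g (lookup (listPart m n a z) i)

  Carries : (BitStr n → BitStr n) → BitStr n → Pred (BitStr (m * n + a)) 0ℓ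
  Carries g u z = ∃ λ i → key g z i ≡ u

  carries? : ∀ g u → Decidable (Carries g u)
  carries? g u z = any? λ i → key g z i ≟ᵇˢ u

  Heavy : (BitStr n → BitStr n) → List (BitStr (m * n + a)) → Pred (BitStr n) 0ℓ
  Heavy g zs u = length zs ≤ 2 * 2 ^ n * count (carries? g u) zs

  heavy? : ∀ g zs → Decidable (Heavy g zs)
  heavy? g zs u = length zs ≤? 2 * 2 ^ n * count (carries? g u) zs

  AllBlocksHeavy : (BitStr n → BitStr n) → List (BitStr (m * n + a)) → Pred (BitStr (m * n + a)) 0ℓ
  AllBlocksHeavy g zs z = ∀ i → Heavy g zs (key g z i)

  allBlocksHeavy? : ∀ g zs → Decidable (AllBlocksHeavy g zs)
  allBlocksHeavy? g zs z = all? λ i → heavy? g zs (key g z i)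

  half-have-all-blocks-heavy : ∀ g zs → length zs ≤ 2 * count (allBlocksHeavy? g zs) zs
  half-have-all-blocks-heavy g zs =
    at-least-half (carries? g) zs (2 ^ n) {{m^n≢0 2 n}} lights lights≤2^n lights-are-light
      (allBlocksHeavy? g zs) someBlockLight
    where
      lights : List (BitStr n)
      lights = filter (∁? (heavy? g zs)) (bitStrings n)
      lights≤2^n : length lights ≤ 2 ^ n
      lights≤2^n = ≤-trans (length-filter (∁? (heavy? g zs)) (bitStrings n)) (≤-reflexive (length-bitStrings n))
      lights-are-light : ∀ {u} → u ∈ lights → 2 * 2 ^ n * count (carries? g u) zs ≤ length zs
      lights-are-light u∈lights = <⇒≤ (≰⇒> (proj₂ (∈-filter⁻ (∁? (heavy? g zs)) {xs = bitStrings n} u∈lights)))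
      someBlockLight : ∀ {z} → ¬ AllBlocksHeavy g zs z → Any (λ u → Carries g u z) lights
      someBlockLight {z} notAll with (i , light) ← ¬∀⟶∃¬ m _ (λ i → heavy? g zs (key g z i)) notAll =
        lose (∈-filter⁺ (∁? (heavy? g zs)) (∈-bitStrings (key g z i)) light) (i , refl)

  NonSolutionSubrectangle : BitStr n → (𝒳 𝒴 : List (BitStr (m * n + a))) → Set
  NonSolutionSubrectangle s 𝒳 𝒴 =
    Σ (List (BitStr (m * n + a))) λ 𝒳′ → Σ (List (BitStr (m * n + a))) λ 𝒴′ →
      Unique 𝒳′ × Unique 𝒴′ ×
      (∀ {x} → x ∈ 𝒳′ → x ∈ 𝒳) × (∀ {y} → y ∈ 𝒴′ → y ∈ 𝒴) ×
      (length 𝒳 * length 𝒴 ≤ 2 ^ (2 * n + 2) * (length 𝒳′ * length 𝒴′)) ×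
      (∀ {x y} → x ∈ 𝒳′ → y ∈ 𝒴′ →
        ¬ IsXMSSolution (listPart m n a x) (listPart m n a y) s)

  sharedKey⇒¬IsXMSSolution : ∀ s {u x y} → Carries id u x → Carries (_⊕ s) u y →
                             ¬ IsXMSSolution (listPart m n a x) (listPart m n a y) s
  sharedKey⇒¬IsXMSSolution s {x = x} {y} (i , xᵢ≡u) (j , yⱼ⊕s≡u) solution = solution i j (begin
    s             ≡⟨ ⊕-cancelʳ s yⱼ ⟨
    (s ⊕ yⱼ) ⊕ yⱼ ≡⟨ cong (_⊕ yⱼ) (⊕-comm s yⱼ) ⟩
    (yⱼ ⊕ s) ⊕ yⱼ ≡⟨ cong (_⊕ yⱼ) (trans yⱼ⊕s≡u (sym xᵢ≡u)) ⟩
    xᵢ ⊕ yⱼ       ∎)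
    where
      open ≡-Reasoning
      xᵢ yⱼ : BitStr n
      xᵢ = lookup (listPart m n a x) i
      yⱼ = lookup (listPart m n a y) j

  module _ (s : BitStr n) {𝒳 𝒴 : List (BitStr (m * n + a))} (unique𝒳 : Unique 𝒳) (unique𝒴 : Unique 𝒴) where

    commonHeavy⇒subrectangle : ∀ {u} → Heavy id 𝒳 u → Heavy (_⊕ s) 𝒴 u → NonSolutionSubrectangle s 𝒳 𝒴
    commonHeavy⇒subrectangle {u} heavy𝒳 heavy𝒴 =
      filter (carries? id u) 𝒳 , filter (carries? (_⊕ s) u) 𝒴 ,
      filter⁺ (carries? id u) unique𝒳 , filter⁺ (carries? (_⊕ s) u) unique𝒴 ,
      proj₁ ∘ ∈𝒳ᵤ , proj₁ ∘ ∈𝒴ᵤ ,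
      product≤2^[2n+2]*product n heavy𝒳 heavy𝒴 ,
      λ x∈ y∈ → sharedKey⇒¬IsXMSSolution s (proj₂ (∈𝒳ᵤ x∈)) (proj₂ (∈𝒴ᵤ y∈))
      where
        ∈𝒳ᵤ : ∀ {x} → x ∈ filter (carries? id u) 𝒳 → x ∈ 𝒳 × Carries id u x
        ∈𝒳ᵤ = ∈-filter⁻ (carries? id u)
        ∈𝒴ᵤ : ∀ {y} → y ∈ filter (carries? (_⊕ s) u) 𝒴 → y ∈ 𝒴 × Carries (_⊕ s) u y
        ∈𝒴ᵤ = ∈-filter⁻ (carries? (_⊕ s) u)

    noCommonHeavy⇒product< : 1 ≤ n → 1 ≤ m → (∀ u → Heavy (_⊕ s) 𝒴 u → ¬ Heavy id 𝒳 u) →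
                             length 𝒳 * length 𝒴 < 2 ^ (2 * n * m + 2 * a ∸ m + 2)
    noCommonHeavy⇒product< 1≤n 1≤m disjoint =
      product<2^[2nm+2a∸m+2] n m a 1≤n 1≤m heavies+lights≡2^n
        (≤-trans (half-have-all-blocks-heavy id 𝒳) (*-monoʳ-≤ 2 𝒳-part≤))
        (≤-trans (half-have-all-blocks-heavy (_⊕ s) 𝒴) (*-monoʳ-≤ 2 𝒴-part≤))
      where
        heavies lights : List (BitStr n)
        heavies = filter (heavy? id 𝒳) (bitStrings n)
        lights  = filter (∁? (heavy? id 𝒳)) (bitStrings n)
        heavies+lights≡2^n : length heavies + length lights ≡ 2 ^ n
        heavies+lights≡2^n = trans (count+count∁≡length (heavy? id 𝒳) (bitStrings n)) (length-bitStrings n)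
        𝒳′ 𝒴′ : List (BitStr (m * n + a))
        𝒳′ = filter (allBlocksHeavy? id 𝒳) 𝒳
        𝒴′ = filter (allBlocksHeavy? (_⊕ s) 𝒴) 𝒴
        blocks∈heavies : ∀ {x} → x ∈ 𝒳′ → ∀ i → lookup (listPart m n a x) i ∈ heavies
        blocks∈heavies x∈ i =
          ∈-filter⁺ (heavy? id 𝒳) (∈-bitStrings _) (proj₂ (∈-filter⁻ (allBlocksHeavy? id 𝒳) {xs = 𝒳} x∈) i)
        blocks∈shiftedLights : ∀ {y} → y ∈ 𝒴′ → ∀ j → lookup (listPart m n a y) j ∈ map (_⊕ s) lights
        blocks∈shiftedLights {y} y∈ j = subst (_∈ map (_⊕ s) lights) (⊕-cancelʳ yⱼ s)
          (∈-map⁺ (_⊕ s) (∈-filter⁺ (∁? (heavy? id 𝒳)) (∈-bitStrings (yⱼ ⊕ s)) (disjoint (yⱼ ⊕ s) yⱼ⊕s-heavy)))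
          where
            yⱼ : BitStr n
            yⱼ = lookup (listPart m n a y) j
            yⱼ⊕s-heavy : Heavy (_⊕ s) 𝒴 (yⱼ ⊕ s)
            yⱼ⊕s-heavy = proj₂ (∈-filter⁻ (allBlocksHeavy? (_⊕ s) 𝒴) {xs = 𝒴} y∈) j
        𝒳-part≤ : length 𝒳′ ≤ length heavies ^ m * 2 ^ a
        𝒳-part≤ = blocksIn⇒length≤ m n a heavies (filter⁺ (allBlocksHeavy? id 𝒳) unique𝒳) blocks∈heavies
        𝒴-part≤ : length 𝒴′ ≤ length lights ^ m * 2 ^ a
        𝒴-part≤ = begin
          length 𝒴′                             ≤⟨ blocksIn⇒length≤ m n a (map (_⊕ s) lights)
                                                      (filter⁺ (allBlocksHeavy? (_⊕ s) 𝒴) unique𝒴) blocks∈shiftedLights ⟩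
          length (map (_⊕ s) lights) ^ m * 2 ^ a ≡⟨ cong (λ k → k ^ m * 2 ^ a) (length-map (_⊕ s) lights) ⟩
          length lights ^ m * 2 ^ a              ∎
          where open ≤-Reasoning

corollary3p3 : (n m a : ℕ) → 1 ≤ n → 1 ≤ m → m * m < 2 ^ n →
    (𝒳 𝒴 : List (BitStr (m * n + a))) → Unique 𝒳 → Unique 𝒴 →
    2 ^ (2 * n * m + 2 * a ∸ m + 2) ≤ length 𝒳 * length 𝒴 →
    (s : BitStr n) →
    Σ (List (BitStr (m * n + a))) λ 𝒳′ → Σ (List (BitStr (m * n + a))) λ 𝒴′ →
      Unique 𝒳′ × Unique 𝒴′ ×
      (∀ {x} → x ∈ 𝒳′ → x ∈ 𝒳) × (∀ {y} → y ∈ 𝒴′ → y ∈ 𝒴) ×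
      (length 𝒳 * length 𝒴 ≤ 2 ^ (2 * n + 2) * (length 𝒳′ * length 𝒴′)) ×
      (∀ {x y} → x ∈ 𝒳′ → y ∈ 𝒴′ →
        ¬ IsXMSSolution (listPart m n a x) (listPart m n a y) s)
corollary3p3 n m a 1≤n 1≤m _ 𝒳 𝒴 unique𝒳 unique𝒴 large s = subrectangle
  where
    open HeavyKeys n m a
    subrectangle : NonSolutionSubrectangle s 𝒳 𝒴
    subrectangle with Any.any? (λ u → heavy? id 𝒳 u ×-dec heavy? (_⊕ s) 𝒴 u) (bitStrings n)
    ... | yes common = let (_ , heavy𝒳 , heavy𝒴) = Any.satisfied common in
                       commonHeavy⇒subrectangle s unique𝒳 unique𝒴 heavy𝒳 heavy𝒴
    ... | no none = ⊥-elim (<⇒≱ (noCommonHeavy⇒product< s unique𝒳 unique𝒴 1≤n 1≤m disjoint) large)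
      where
        disjoint : ∀ u → Heavy (_⊕ s) 𝒴 u → ¬ Heavy id 𝒳 u
        disjoint u heavy𝒴 heavy𝒳 = none (lose (∈-bitStrings u) (heavy𝒳 , heavy𝒴))
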